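{- For $k\ge1$ define the formal power series $F_k(q)$ by \[ \sum_{n_1,n_2,\dotsc,n_{2k+1} \geq 0 } \frac{q^{\sum_{i=1}^{2k+1} n_i^2-\sum_{i=1}^{2k} n_{i} n_{i+1} }} {(q)_{n_1}^2 (q)_{n_2}^2 \cdots (q)_{n_{2k+1}}^2} = \frac{1}{(q)_\infty^{2k+1}} F_k(q). \] Then \[ F_k(q)=1+(2k+1)k\, q+ \tfrac{1}{3} k(3+5k+4k^3)\, q^2 +O(q^3). \]
   Context: $(q)_n=\prod_{i=1}^{n}(1-q^i)$ and $(q)_\infty=\prod_{i\ge1}(1-q^i)$; all series are regarded as formal power series in $q$. -}

module Defs where

open import Data.Nat as ℕ using (ℕ; zero; suc)
open import Data.Nat.Divisibility using (_∣?_)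
open import Data.Integer using (ℤ; +_; _+_; _*_; -_; _-_)
open import Data.Bool using (if_then_else_)
open import Data.List using (List; []; _∷_; map; concatMap; upTo)
open import Data.Vec using (Vec; []; _∷_)
open import Relation.Nullary using (does)
open import Relation.Binary.PropositionalEquality using (_≡_)

-- Formal power series in q with integer coefficients, as coefficient functions.
Series : Set
Series = ℕ → ℤ

sumTo : ℕ → (ℕ → ℤ) → ℤ
sumTo zero    f = f 0
sumTo (suc m) f = sumTo m f + f (suc m)

oneS : Series
oneS zero    = + 1
oneS (suc _) = + 0

mono : ℕ → Series
mono i m = if does (i ℕ.≟ m) then + 1 else + 0

_⊝_ : Series → Series → Series
(a ⊝ b) m = a m - b m

_⊛_ : Series → Series → Series
(a ⊛ b) m = sumTo m (λ j → a j * b (m ℕ.∸ j))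

infixl 7 _⊛_
infixl 6 _⊝_

powS : Series → ℕ → Series
powS a zero    = oneS
powS a (suc n) = powS a n ⊛ a

poch : ℕ → Series
poch zero    = oneS
poch (suc n) = poch n ⊛ (oneS ⊝ mono (suc n))

-- (q)_∞ : its q^m coefficient equals that of (q)_m
pochInf : Series
pochInf m = poch m m

-- 1/(1 - q^(suc i)) = Σ_t q^((suc i) t)
geom : ℕ → Series
geom i m = if does (suc i ∣? m) then + 1 else + 0

invPoch : ℕ → Series
invPoch zero    = oneS
invPoch (suc n) = invPoch n ⊛ geom n

-- q^e · X for an integer exponent e (here always e ≥ 0):
-- coefficient m is Σ_{j ≤ m, e + j = m} X j.
shiftZ : ℤ → Series → Series
shiftZ e X m = sumTo m (λ j → if does (e Data.Integer.≟ (+ m - + j)) then X j else + 0)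

sumSq : ∀ {d} → Vec ℕ d → ℤ
sumSq []      = + 0
sumSq (x ∷ v) = + (x ℕ.* x) + sumSq v

adjProd : ∀ {d} → Vec ℕ d → ℤ
adjProd []            = + 0
adjProd (x ∷ [])      = + 0
adjProd (x ∷ y ∷ v)   = + (x ℕ.* y) + adjProd (y ∷ v)

quadExp : ∀ {d} → Vec ℕ d → ℤ
quadExp v = sumSq v - adjProd v

denomInv : ∀ {d} → Vec ℕ d → Series
denomInv []      = oneS
denomInv (x ∷ v) = invPoch x ⊛ invPoch x ⊛ denomInv v

summand : ∀ {d} → Vec ℕ d → Series
summand v = shiftZ (quadExp v) (denomInv v)

box : (d B : ℕ) → List (Vec ℕ d)
box zero    B = [] ∷ []
box (suc d) B = concatMap (λ x → map (x ∷_) (box d B)) (upTo (suc B))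

sumList : List Series → Series
sumList []       m = + 0
sumList (s ∷ ss) m = s m + sumList ss m

multisumBox : (d B : ℕ) → Series
multisumBox d B = sumList (map summand (box d B))

-- (q)_∞^{2k+1} times the partial multisum; F_k is the q-adic limit as B → ∞
FkBox : (k B : ℕ) → Series
FkBox k B = powS pochInf (suc (2 ℕ.* k)) ⊛ multisumBox (suc (2 ℕ.* k)) B

module Submission where

-- Put t = q^{1/2}.  Completing squares,
--   Σ nᵢ² − Σ nᵢ nᵢ₊₁ = ½ G(0, n₁, …, n_d),   G(x₀,…,x_d) = Σ (xᵢ − xᵢ₊₁)² + x_d²,
-- so each summand of the multisum is the even part of t^{G(0,n)} ∏ 1/(q)²_{nᵢ}.
-- Since G is a sum of nearest-neighbour terms, the box sums
--   A_s(x) = Σ_{w ∈ {0..B}^s} t^{G(x,w)} ∏_{v ∈ x∷w} 1/(q)²_v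
-- satisfy the transfer recursion A_{s+1}(x) = Σ_{y ≤ B} t^{(x−y)²} (q)_x^{-2} A_s(y),
-- and the multisum over {0..B}^d is the even part of A_d(0).
-- Only coefficients up to q² are needed, so we compute in the jet rings
-- ℤ[t]/(t⁵) and ℤ[q]/(q³).  As t^y divides A_s(y), for B ≥ 2 the recursion closes
-- on a few coefficients of A_s(0), A_s(1), A_s(2) (the profile), which follow
-- explicit recurrences with polynomial closed forms.  Multiplying by the q-jet of
-- (q)_∞^d and putting d = 2k+1 gives the theorem.

open import Defs
open import Data.Nat using (ℕ; _≤_)
open import Data.Integer using (+_)
open import Data.Product using (∃; _×_)
open import Relation.Binary.PropositionalEquality using (_≡_)
open import Data.Nat as N using ()
open import Data.Integer as Z using ()

open import Data.Nat using (zero; suc; z≤n; s≤s)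
open import Data.Integer using (ℤ; _+_; _*_; -_; _-_; -[1+_]; +0)
open import Data.Integer.Tactic.RingSolver using (solve-∀)
import Data.Integer.Properties as ZP
import Data.Nat.Properties as NP
open import Data.List using (List; []; _∷_; map; concatMap; upTo; applyUpTo; _++_)
open import Data.List.Relation.Unary.All using (All; []; _∷_; universal)
open import Data.List.Relation.Unary.All.Properties using (applyUpTo⁺₂)
open import Data.Vec using (Vec; []; _∷_)
open import Data.Product using (Σ; _,_; proj₁; proj₂)
open import Data.Sum using (inj₁; inj₂)
open import Relation.Binary.PropositionalEquality
  using (refl; sym; trans; cong; cong₂; subst; module ≡-Reasoning)
open ≡-Reasoning

-- ℤ[t]/(t⁵), coefficient of tⁱ in field tᵢ.
record Jet₅ : Set where
  constructor jet₅
  field t0 t1 t2 t3 t4 : ℤ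
open Jet₅

-- ℤ[q]/(q³).
record Jet₃ : Set where
  constructor jet₃
  field q0 q1 q2 : ℤ
open Jet₃

jet₅-cong : ∀ {a0 a1 a2 a3 a4 b0 b1 b2 b3 b4} →
  a0 ≡ b0 → a1 ≡ b1 → a2 ≡ b2 → a3 ≡ b3 → a4 ≡ b4 → jet₅ a0 a1 a2 a3 a4 ≡ jet₅ b0 b1 b2 b3 b4
jet₅-cong refl refl refl refl refl = refl

jet₃-cong : ∀ {a0 a1 a2 b0 b1 b2} → a0 ≡ b0 → a1 ≡ b1 → a2 ≡ b2 → jet₃ a0 a1 a2 ≡ jet₃ b0 b1 b2
jet₃-cong refl refl refl = refl

0₅ : Jet₅
0₅ = jet₅ +0 +0 +0 +0 +0

infixl 6 _+₅_
infixl 7 _*₅_ _*₃_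

_+₅_ : Jet₅ → Jet₅ → Jet₅
a +₅ b = jet₅ (t0 a + t0 b) (t1 a + t1 b) (t2 a + t2 b) (t3 a + t3 b) (t4 a + t4 b)

_*₅_ : Jet₅ → Jet₅ → Jet₅
jet₅ a0 a1 a2 a3 a4 *₅ jet₅ b0 b1 b2 b3 b4 =
  jet₅ (a0 * b0) (a0 * b1 + a1 * b0) (a0 * b2 + a1 * b1 + a2 * b0)
       (a0 * b3 + a1 * b2 + a2 * b1 + a3 * b0)
       (a0 * b4 + a1 * b3 + a2 * b2 + a3 * b1 + a4 * b0)

t·_ : Jet₅ → Jet₅
t· a = jet₅ +0 (t0 a) (t1 a) (t2 a) (t3 a)

t^_·_ : ℕ → Jet₅ → Jet₅
t^ zero  · a = a
t^ suc n · a = t· (t^ n · a)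

_+₃_ : Jet₃ → Jet₃ → Jet₃
a +₃ b = jet₃ (q0 a + q0 b) (q1 a + q1 b) (q2 a + q2 b)

_*₃_ : Jet₃ → Jet₃ → Jet₃
a *₃ b = jet₃ (q0 a * q0 b) (q0 a * q1 b + q1 a * q0 b) ((q0 a * q2 b + q1 a * q1 b) + q2 a * q0 b)

⌊_⌋₃ : Series → Jet₃
⌊ X ⌋₃ = jet₃ (X 0) (X 1) (X 2)

-- Substitution q ↦ t², and its left inverse: the even part.
dil : Jet₃ → Jet₅
dil b = jet₅ (q0 b) +0 (q1 b) +0 (q2 b)

even : Jet₅ → Jet₃
even a = jet₃ (t0 a) (t2 a) (t4 a)

⌊⌋₃-⊛ : ∀ a b → ⌊ a ⊛ b ⌋₃ ≡ ⌊ a ⌋₃ *₃ ⌊ b ⌋₃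
⌊⌋₃-⊛ a b = refl

*₃-identityˡ : ∀ b → jet₃ (+ 1) +0 +0 *₃ b ≡ b
*₃-identityˡ (jet₃ b0 b1 b2) = jet₃-cong (c0 b0) (c1 b0 b1) (c2 b0 b1 b2)
  where
  c0 : ∀ b0 → + 1 * b0 ≡ b0
  c0 = solve-∀
  c1 : ∀ b0 b1 → + 1 * b1 + +0 * b0 ≡ b1
  c1 = solve-∀
  c2 : ∀ b0 b1 b2 → (+ 1 * b2 + +0 * b1) + +0 * b0 ≡ b2
  c2 = solve-∀

+₅-assoc : ∀ a b c → (a +₅ b) +₅ c ≡ a +₅ (b +₅ c)
+₅-assoc a b c = jet₅-cong (ZP.+-assoc (t0 a) _ _) (ZP.+-assoc (t1 a) _ _) (ZP.+-assoc (t2 a) _ _)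
                           (ZP.+-assoc (t3 a) _ _) (ZP.+-assoc (t4 a) _ _)

+₅-identityˡ : ∀ a → 0₅ +₅ a ≡ a
+₅-identityˡ a = jet₅-cong (ZP.+-identityˡ (t0 a)) (ZP.+-identityˡ (t1 a)) (ZP.+-identityˡ (t2 a))
                           (ZP.+-identityˡ (t3 a)) (ZP.+-identityˡ (t4 a))

*₅-distribˡ-+₅ : ∀ a b c → a *₅ (b +₅ c) ≡ a *₅ b +₅ a *₅ c
*₅-distribˡ-+₅ (jet₅ a0 a1 a2 a3 a4) (jet₅ b0 b1 b2 b3 b4) (jet₅ d0 d1 d2 d3 d4) =
  jet₅-cong (c0 a0 b0 d0) (c1 a0 a1 b0 b1 d0 d1) (c2 a0 a1 a2 b0 b1 b2 d0 d1 d2)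
            (c3 a0 a1 a2 a3 b0 b1 b2 b3 d0 d1 d2 d3) (c4 a0 a1 a2 a3 a4 b0 b1 b2 b3 b4 d0 d1 d2 d3 d4)
  where
  c0 : ∀ a0 b0 d0 → a0 * (b0 + d0) ≡ a0 * b0 + a0 * d0
  c0 = solve-∀
  c1 : ∀ a0 a1 b0 b1 d0 d1 →
    a0 * (b1 + d1) + a1 * (b0 + d0) ≡ (a0 * b1 + a1 * b0) + (a0 * d1 + a1 * d0)
  c1 = solve-∀
  c2 : ∀ a0 a1 a2 b0 b1 b2 d0 d1 d2 →
    a0 * (b2 + d2) + a1 * (b1 + d1) + a2 * (b0 + d0)
      ≡ (a0 * b2 + a1 * b1 + a2 * b0) + (a0 * d2 + a1 * d1 + a2 * d0)
  c2 = solve-∀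
  c3 : ∀ a0 a1 a2 a3 b0 b1 b2 b3 d0 d1 d2 d3 →
    a0 * (b3 + d3) + a1 * (b2 + d2) + a2 * (b1 + d1) + a3 * (b0 + d0)
      ≡ (a0 * b3 + a1 * b2 + a2 * b1 + a3 * b0) + (a0 * d3 + a1 * d2 + a2 * d1 + a3 * d0)
  c3 = solve-∀
  c4 : ∀ a0 a1 a2 a3 a4 b0 b1 b2 b3 b4 d0 d1 d2 d3 d4 →
    a0 * (b4 + d4) + a1 * (b3 + d3) + a2 * (b2 + d2) + a3 * (b1 + d1) + a4 * (b0 + d0)
      ≡ (a0 * b4 + a1 * b3 + a2 * b2 + a3 * b1 + a4 * b0) + (a0 * d4 + a1 * d3 + a2 * d2 + a3 * d1 + a4 * d0)
  c4 = solve-∀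

*₅-zeroʳ : ∀ a → a *₅ 0₅ ≡ 0₅
*₅-zeroʳ (jet₅ a0 a1 a2 a3 a4) =
  jet₅-cong (c0 a0) (c1 a0 a1) (c2 a0 a1 a2) (c3 a0 a1 a2 a3) (c4 a0 a1 a2 a3 a4)
  where
  c0 : ∀ a0 → a0 * +0 ≡ +0
  c0 = solve-∀
  c1 : ∀ a0 a1 → a0 * +0 + a1 * +0 ≡ +0
  c1 = solve-∀
  c2 : ∀ a0 a1 a2 → a0 * +0 + a1 * +0 + a2 * +0 ≡ +0
  c2 = solve-∀
  c3 : ∀ a0 a1 a2 a3 → a0 * +0 + a1 * +0 + a2 * +0 + a3 * +0 ≡ +0
  c3 = solve-∀
  c4 : ∀ a0 a1 a2 a3 a4 → a0 * +0 + a1 * +0 + a2 * +0 + a3 * +0 + a4 * +0 ≡ +0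
  c4 = solve-∀

*₅-t· : ∀ a b → a *₅ (t· b) ≡ t· (a *₅ b)
*₅-t· (jet₅ a0 a1 a2 a3 a4) (jet₅ b0 b1 b2 b3 b4) =
  jet₅-cong (c0 a0) (c1 a0 a1 b0) (c2 a0 a1 a2 b0 b1) (c3 a0 a1 a2 a3 b0 b1 b2)
            (c4 a0 a1 a2 a3 a4 b0 b1 b2 b3)
  where
  c0 : ∀ a0 → a0 * +0 ≡ +0
  c0 = solve-∀
  c1 : ∀ a0 a1 b0 → a0 * b0 + a1 * +0 ≡ a0 * b0
  c1 = solve-∀
  c2 : ∀ a0 a1 a2 b0 b1 → a0 * b1 + a1 * b0 + a2 * +0 ≡ a0 * b1 + a1 * b0
  c2 = solve-∀
  c3 : ∀ a0 a1 a2 a3 b0 b1 b2 →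
    a0 * b2 + a1 * b1 + a2 * b0 + a3 * +0 ≡ a0 * b2 + a1 * b1 + a2 * b0
  c3 = solve-∀
  c4 : ∀ a0 a1 a2 a3 a4 b0 b1 b2 b3 →
    a0 * b3 + a1 * b2 + a2 * b1 + a3 * b0 + a4 * +0 ≡ a0 * b3 + a1 * b2 + a2 * b1 + a3 * b0
  c4 = solve-∀

*₅-t^ : ∀ n a b → a *₅ (t^ n · b) ≡ t^ n · (a *₅ b)
*₅-t^ zero    a b = refl
*₅-t^ (suc n) a b = trans (*₅-t· a (t^ n · b)) (cong t·_ (*₅-t^ n a b))

t^-+ : ∀ m n a → t^ (m N.+ n) · a ≡ t^ m · (t^ n · a)
t^-+ zero    n a = refl
t^-+ (suc m) n a = cong t·_ (t^-+ m n a)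

t^-distrib : ∀ n a b → t^ n · (a +₅ b) ≡ t^ n · a +₅ t^ n · b
t^-distrib zero    a b = refl
t^-distrib (suc n) a b = cong t·_ (t^-distrib n a b)

t^-zero : ∀ n → t^ n · 0₅ ≡ 0₅
t^-zero zero    = refl
t^-zero (suc n) = cong t·_ (t^-zero n)

t^-vanishes : ∀ {n} a → 5 ≤ n → t^ n · a ≡ 0₅
t^-vanishes a (s≤s (s≤s (s≤s (s≤s (s≤s _))))) = refl

dil-*₃ : ∀ a b → dil (a *₃ b) ≡ dil a *₅ dil b
dil-*₃ (jet₃ a0 a1 a2) (jet₃ b0 b1 b2) = jet₅-cong refl (c1 a0) (c2 a0 a1 b0 b1) (c3 a0 a1) (c4 a0 a1 a2 b0 b1 b2)
  where
  c1 : ∀ a0 → +0 ≡ a0 * +0 + +0 * a0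
  c1 = solve-∀
  c2 : ∀ a0 a1 b0 b1 → a0 * b1 + a1 * b0 ≡ a0 * b1 + +0 * +0 + a1 * b0
  c2 = solve-∀
  c3 : ∀ a0 a1 → +0 ≡ a0 * +0 + +0 * a1 + a1 * +0 + +0 * a0
  c3 = solve-∀
  c4 : ∀ a0 a1 a2 b0 b1 b2 →
    (a0 * b2 + a1 * b1) + a2 * b0 ≡ a0 * b2 + +0 * +0 + a1 * b1 + +0 * +0 + a2 * b0
  c4 = solve-∀

-- Multiplication by an even jet 1 + k₂t² + k₄t⁴, the shape of every 1/(q)²_x.
evenUnit : ℤ → ℤ → Jet₅ → Jet₅
evenUnit k2 k4 b =
  jet₅ (t0 b) (t1 b) (t2 b + k2 * t0 b) (t3 b + k2 * t1 b) (t4 b + k2 * t2 b + k4 * t0 b)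

*₅-evenUnit : ∀ k2 k4 b → jet₅ (+ 1) +0 k2 +0 k4 *₅ b ≡ evenUnit k2 k4 b
*₅-evenUnit k2 k4 (jet₅ b0 b1 b2 b3 b4) =
  jet₅-cong (c0 b0) (c1 b0 b1) (c2 k2 b0 b1 b2) (c3 k2 b0 b1 b2 b3) (c4 k2 k4 b0 b1 b2 b3 b4)
  where
  c0 : ∀ b0 → + 1 * b0 ≡ b0
  c0 = solve-∀
  c1 : ∀ b0 b1 → + 1 * b1 + +0 * b0 ≡ b1
  c1 = solve-∀
  c2 : ∀ k2 b0 b1 b2 → + 1 * b2 + +0 * b1 + k2 * b0 ≡ b2 + k2 * b0
  c2 = solve-∀
  c3 : ∀ k2 b0 b1 b2 b3 → + 1 * b3 + +0 * b2 + k2 * b1 + +0 * b0 ≡ b3 + k2 * b1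
  c3 = solve-∀
  c4 : ∀ k2 k4 b0 b1 b2 b3 b4 →
    + 1 * b4 + +0 * b3 + k2 * b2 + +0 * b1 + k4 * b0 ≡ b4 + k2 * b2 + k4 * b0
  c4 = solve-∀

Σ₅ : {A : Set} → (A → Jet₅) → List A → Jet₅
Σ₅ f []       = 0₅
Σ₅ f (x ∷ xs) = f x +₅ Σ₅ f xs

Σ₅-cong : {A : Set} {f g : A → Jet₅} → (∀ x → f x ≡ g x) → ∀ xs → Σ₅ f xs ≡ Σ₅ g xs
Σ₅-cong f≡g []       = refl
Σ₅-cong f≡g (x ∷ xs) = cong₂ _+₅_ (f≡g x) (Σ₅-cong f≡g xs)

Σ₅-++ : {A : Set} (f : A → Jet₅) (xs ys : List A) → Σ₅ f (xs ++ ys) ≡ Σ₅ f xs +₅ Σ₅ f ys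
Σ₅-++ f []       ys = sym (+₅-identityˡ _)
Σ₅-++ f (x ∷ xs) ys = trans (cong (f x +₅_) (Σ₅-++ f xs ys)) (sym (+₅-assoc (f x) (Σ₅ f xs) (Σ₅ f ys)))

Σ₅-map : {A B : Set} (f : B → Jet₅) (g : A → B) (xs : List A) → Σ₅ f (map g xs) ≡ Σ₅ (λ x → f (g x)) xs
Σ₅-map f g []       = refl
Σ₅-map f g (x ∷ xs) = cong (f (g x) +₅_) (Σ₅-map f g xs)

Σ₅-concatMap : {A B : Set} (f : B → Jet₅) (g : A → List B) (ys : List A) →
  Σ₅ f (concatMap g ys) ≡ Σ₅ (λ y → Σ₅ f (g y)) ys
Σ₅-concatMap f g []       = refl
Σ₅-concatMap f g (y ∷ ys) = trans (Σ₅-++ f (g y) (concatMap g ys)) (cong (Σ₅ f (g y) +₅_) (Σ₅-concatMap f g ys))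

Additive : (Jet₅ → Jet₅) → Set
Additive h = h 0₅ ≡ 0₅ × (∀ a b → h (a +₅ b) ≡ h a +₅ h b)

Σ₅-linear : {A : Set} (h : Jet₅ → Jet₅) → Additive h → (f : A → Jet₅) (xs : List A) →
  Σ₅ (λ x → h (f x)) xs ≡ h (Σ₅ f xs)
Σ₅-linear h (h0 , h+) f []       = sym h0
Σ₅-linear h (h0 , h+) f (x ∷ xs) = trans (cong (h (f x) +₅_) (Σ₅-linear h (h0 , h+) f xs)) (sym (h+ _ _))

infix 4 t^_∣_

t^_∣_ : ℕ → Jet₅ → Set
t^ n ∣ a = Σ Jet₅ λ b → a ≡ t^ n · b

∣-weaken : ∀ {m n a} → m ≤ n → t^ n ∣ a → t^ m ∣ a
∣-weaken {m} {n} m≤n (b , a≡) =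
  t^ (n N.∸ m) · b , trans a≡ (trans (cong (λ e → t^ e · b) (sym (NP.m+[n∸m]≡n m≤n))) (t^-+ m _ b))

∣-t^ : ∀ {m a} n → t^ m ∣ a → t^ (n N.+ m) ∣ t^ n · a
∣-t^ {m} n (b , refl) = b , sym (t^-+ n m b)

∣-*₅ : ∀ {m a} c → t^ m ∣ a → t^ m ∣ c *₅ a
∣-*₅ {m} c (b , refl) = c *₅ b , *₅-t^ m c b

∣-Σ₅ : {A : Set} {m : ℕ} (f : A → Jet₅) (xs : List A) → All (λ x → t^ m ∣ f x) xs → t^ m ∣ Σ₅ f xs
∣-Σ₅ {m = m} f []       []               = 0₅ , sym (t^-zero m)
∣-Σ₅ {m = m} f (x ∷ xs) ((b , fx≡) ∷ ps) with ∣-Σ₅ f xs ps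
... | c , rest≡ = b +₅ c , trans (cong₂ _+₅_ fx≡ rest≡) (sym (t^-distrib m b c))

∣-vanishes : ∀ {a} → t^ 5 ∣ a → a ≡ 0₅
∣-vanishes (b , a≡) = trans a≡ (t^-vanishes b NP.≤-refl)

square : ℤ → ℕ
square (+ n)    = n N.* n
square -[1+ n ] = suc n N.* suc n

square-correct : ∀ z → + square z ≡ z * z
square-correct (+ n)    = ZP.pos-* n n
square-correct -[1+ n ] = refl

n≤square : ∀ n → n ≤ n N.* n
n≤square zero    = z≤n
n≤square (suc n) = NP.m≤m*n (suc n) (suc n)

gapSquares : ∀ {d} → Vec ℕ (suc d) → ℕ
gapSquares (x ∷ [])    = x N.* x
gapSquares (x ∷ y ∷ u) = square (+ x - + y) N.+ gapSquares (y ∷ u)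

-- t^x divides t^{G(x,…)}: the first gap and the tail together make up at least x.
x≤gapSquares : ∀ {d} x (w : Vec ℕ d) → x ≤ gapSquares (x ∷ w)
x≤gapSquares x []      = n≤square x
x≤gapSquares x (y ∷ u) with NP.≤-total x y
... | inj₁ x≤y = NP.≤-trans x≤y (NP.≤-trans (x≤gapSquares y u) (NP.m≤n+m _ _))
... | inj₂ y≤x = subst (_≤ square (+ x - + y) N.+ gapSquares (y ∷ u)) (NP.m∸n+n≡m y≤x)
                   (NP.+-mono-≤ gap≤ (x≤gapSquares y u))
  where
  gap≤ : x N.∸ y ≤ square (+ x - + y)
  gap≤ = subst (λ z → x N.∸ y ≤ square z) (sym (trans (ZP.m-n≡m⊖n x y) (ZP.⊖-≥ y≤x)))
               (n≤square (x N.∸ y))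

-- One completing-squares step: the identity for the tuple y ∷ u (ih) gives the
-- identity for x ∷ y ∷ u; XX, XY, YY stand for the casts of x², xy, y².
square-step : ∀ {XX XY YY} X Y S P g → XX ≡ X * X → XY ≡ X * Y → YY ≡ Y * Y →
  Y * Y + g ≡ ((YY + S) - P) + ((YY + S) - P) →
  X * X + ((X - Y) * (X - Y) + g) ≡ ((XX + (YY + S)) - (XY + P)) + ((XX + (YY + S)) - (XY + P))
square-step X Y S P g refl refl refl ih = begin
  X * X + ((X - Y) * (X - Y) + g)                          ≡⟨ regroup X Y g ⟩
  X * X + (X - Y) * (X - Y) - Y * Y + (Y * Y + g)          ≡⟨ cong (λ h → X * X + (X - Y) * (X - Y) - Y * Y + h) ih ⟩
  X * X + (X - Y) * (X - Y) - Y * Y + (Q + Q)              ≡⟨ expand X Y S P ⟩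
  ((X * X + (Y * Y + S)) - (X * Y + P)) + ((X * X + (Y * Y + S)) - (X * Y + P)) ∎
  where
  Q : ℤ
  Q = (Y * Y + S) - P
  regroup : ∀ X Y g → X * X + ((X - Y) * (X - Y) + g) ≡ X * X + (X - Y) * (X - Y) - Y * Y + (Y * Y + g)
  regroup = solve-∀
  expand : ∀ X Y S P → X * X + (X - Y) * (X - Y) - Y * Y + (((Y * Y + S) - P) + ((Y * Y + S) - P))
                     ≡ ((X * X + (Y * Y + S)) - (X * Y + P)) + ((X * X + (Y * Y + S)) - (X * Y + P))
  expand = solve-∀

complete-squares : ∀ {d} x (w : Vec ℕ d) → + x * + x + + gapSquares (x ∷ w) ≡ quadExp (x ∷ w) + quadExp (x ∷ w)
complete-squares x [] = trans (cong (_+ + (x N.* x)) (sym (ZP.pos-* x x))) (double (+ (x N.* x)))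
  where
  double : ∀ T → T + T ≡ ((T + +0) - +0) + ((T + +0) - +0)
  double = solve-∀
complete-squares x (y ∷ u) = begin
  + x * + x + + (square (+ x - + y) N.+ gapSquares (y ∷ u))
    ≡⟨ cong (λ h → + x * + x + h) (ZP.pos-+ (square (+ x - + y)) _) ⟩
  + x * + x + (+ square (+ x - + y) + + gapSquares (y ∷ u))
    ≡⟨ cong (λ s → + x * + x + (s + + gapSquares (y ∷ u))) (square-correct (+ x - + y)) ⟩
  + x * + x + ((+ x - + y) * (+ x - + y) + + gapSquares (y ∷ u))
    ≡⟨ square-step (+ x) (+ y) (sumSq u) (adjProd (y ∷ u)) (+ gapSquares (y ∷ u)) (ZP.pos-* x x) (ZP.pos-* x y) (ZP.pos-* y y)
                   (complete-squares y u) ⟩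
  quadExp (x ∷ y ∷ u) + quadExp (x ∷ y ∷ u) ∎

gapSquares-0∷ : ∀ {d} (v : Vec ℕ d) → + gapSquares (0 ∷ v) ≡ quadExp v + quadExp v
gapSquares-0∷ []      = refl
gapSquares-0∷ (x ∷ w) = begin
  + (square (+0 - + x) N.+ gapSquares (x ∷ w))  ≡⟨ ZP.pos-+ (square (+0 - + x)) _ ⟩
  + square (+0 - + x) + + gapSquares (x ∷ w)    ≡⟨ cong (_+ + gapSquares (x ∷ w)) (trans (square-correct (+0 - + x)) (neg² (+ x))) ⟩
  + x * + x + + gapSquares (x ∷ w)              ≡⟨ complete-squares x w ⟩
  quadExp (x ∷ w) + quadExp (x ∷ w)             ∎
  where
  neg² : ∀ X → (+0 - X) * (+0 - X) ≡ X * X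
  neg² = solve-∀

W : ∀ {d} → Vec ℕ (suc d) → Jet₅
W v = t^ gapSquares v · dil ⌊ denomInv v ⌋₃

W-order : ∀ {d} y (w : Vec ℕ d) → t^ y ∣ W (y ∷ w)
W-order y w = ∣-weaken (x≤gapSquares y w) (dil ⌊ denomInv (y ∷ w) ⌋₃ , refl)

D : ℕ → Jet₅
D x = dil ⌊ invPoch x ⊛ invPoch x ⌋₃

step : ℕ → ℕ → Jet₅ → Jet₅
step x y a = t^ square (+ x - + y) · (D x *₅ a)

step-additive : ∀ x y → Additive (step x y)
step-additive x y =
    trans (cong (λ a → t^ e · a) (*₅-zeroʳ (D x))) (t^-zero e)
  , λ a b → trans (cong (λ c → t^ e · c) (*₅-distribˡ-+₅ (D x) a b)) (t^-distrib e (D x *₅ a) (D x *₅ b))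
  where
  e : ℕ
  e = square (+ x - + y)

W-step : ∀ {d} x y (u : Vec ℕ d) → W (x ∷ y ∷ u) ≡ step x y (W (y ∷ u))
W-step x y u = begin
  t^ (e N.+ g) · dil (head *₃ tail)    ≡⟨ t^-+ e g (dil (head *₃ tail)) ⟩
  t^ e · (t^ g · dil (head *₃ tail))    ≡⟨ cong (λ a → t^ e · (t^ g · a)) (dil-*₃ head tail) ⟩
  t^ e · (t^ g · (D x *₅ dil tail))     ≡⟨ cong (λ a → t^ e · a) (sym (*₅-t^ g (D x) (dil tail))) ⟩
  step x y (W (y ∷ u))                  ∎
  where
  e : ℕ
  e = square (+ x - + y)
  g : ℕ
  g = gapSquares (y ∷ u)
  head : Jet₃
  head = ⌊ invPoch x ⊛ invPoch x ⌋₃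
  tail : Jet₃
  tail = ⌊ denomInv (y ∷ u) ⌋₃

shiftZ-jet : ∀ e n X → + n ≡ e + e → ⌊ shiftZ e X ⌋₃ ≡ even (t^ n · dil ⌊ X ⌋₃)
shiftZ-jet (+ 0) _ X refl = jet₃-cong refl (ZP.+-identityˡ (X 1)) (ZP.+-identityˡ (X 2))
shiftZ-jet (+ 1) _ X refl =
  jet₃-cong refl (ZP.+-identityʳ (X 0)) (trans (ZP.+-identityʳ _) (ZP.+-identityˡ (X 1)))
shiftZ-jet (+ 2) _ X refl = jet₃-cong refl refl (trans (ZP.+-identityʳ _) (ZP.+-identityʳ (X 0)))
shiftZ-jet (+ suc (suc (suc k))) n X n≡ = sym (cong even (t^-vanishes (dil ⌊ X ⌋₃) 5≤n))
  where
  5≤n : 5 ≤ n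
  5≤n = subst (5 ≤_) (sym (ZP.+-injective n≡))
              (s≤s (s≤s (s≤s (NP.≤-trans (s≤s (s≤s z≤n)) (NP.m≤n+m (3 N.+ k) k)))))
shiftZ-jet -[1+ k ] n X ()

summand-jet : ∀ {d} (v : Vec ℕ d) → ⌊ summand v ⌋₃ ≡ even (W (0 ∷ v))
summand-jet v = begin
  ⌊ shiftZ (quadExp v) (denomInv v) ⌋₃          ≡⟨ shiftZ-jet (quadExp v) g (denomInv v) (gapSquares-0∷ v) ⟩
  even (t^ g · dil ⌊ denomInv v ⌋₃)             ≡⟨ cong (λ b → even (t^ g · dil b)) (sym (*₃-identityˡ _)) ⟩
  even (W (0 ∷ v))                              ∎
  where
  g : ℕ
  g = gapSquares (0 ∷ v)

module Transfer (B : ℕ) where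

  A : ℕ → ℕ → Jet₅
  A s x = Σ₅ (λ w → W (x ∷ w)) (box s B)

  transfer : ∀ s x → A (suc s) x ≡ Σ₅ (λ y → step x y (A s y)) (upTo (suc B))
  transfer s x = begin
    Σ₅ (λ w → W (x ∷ w)) (concatMap (λ y → map (y ∷_) (box s B)) (upTo (suc B)))
      ≡⟨ Σ₅-concatMap (λ w → W (x ∷ w)) (λ y → map (y ∷_) (box s B)) (upTo (suc B)) ⟩
    Σ₅ (λ y → Σ₅ (λ w → W (x ∷ w)) (map (y ∷_) (box s B))) (upTo (suc B))
      ≡⟨ Σ₅-cong one-step (upTo (suc B)) ⟩
    Σ₅ (λ y → step x y (A s y)) (upTo (suc B)) ∎
    where
    one-step : ∀ y → Σ₅ (λ w → W (x ∷ w)) (map (y ∷_) (box s B)) ≡ step x y (A s y)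
    one-step y = begin
      Σ₅ (λ w → W (x ∷ w)) (map (y ∷_) (box s B)) ≡⟨ Σ₅-map (λ w → W (x ∷ w)) (y ∷_) (box s B) ⟩
      Σ₅ (λ u → W (x ∷ y ∷ u)) (box s B)          ≡⟨ Σ₅-cong (W-step x y) (box s B) ⟩
      Σ₅ (λ u → step x y (W (y ∷ u))) (box s B)   ≡⟨ Σ₅-linear (step x y) (step-additive x y) (λ u → W (y ∷ u)) (box s B) ⟩
      step x y (A s y)                            ∎

  A-order : ∀ s y → t^ y ∣ A s y
  A-order s y = ∣-Σ₅ (λ w → W (y ∷ w)) (box s B) (universal (W-order y) (box s B))

  multisum-jet : ∀ d → ⌊ multisumBox d B ⌋₃ ≡ even (A d 0)
  multisum-jet d = sum-jet (box d B)
    where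
    sum-jet : ∀ vs → ⌊ sumList (map summand vs) ⌋₃ ≡ even (Σ₅ (λ v → W (0 ∷ v)) vs)
    sum-jet []       = refl
    sum-jet (v ∷ vs) = cong₂ _+₃_ (summand-jet v) (sum-jet vs)

-- Triangular numbers: the t²-coefficient of A_s(0) and of A_s(2).
tri : ℕ → ℤ
tri zero    = +0
tri (suc s) = tri s + (+ 1 + + s)

-- The t³-coefficient of A_s(1).
β : ℕ → ℤ
β zero    = + 2
β (suc s) = β s + tri s + tri s + + 2 + + 2 * (+ 1 + + s)

-- The t⁴-coefficient of A_s(0).
α : ℕ → ℤ
α zero    = +0
α (suc s) = α s + β s

-- Box sums over {0..B}ᵈ with B = B' + 2, so that y = 0, 1, 2 are all states.
module LargeBox (B' : ℕ) where
  open Transfer (suc (suc B'))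

  far : ℕ → ℕ → Jet₅
  far x s = Σ₅ (λ y → step x y (A s y)) (applyUpTo (λ i → 3 N.+ i) B')

  far-order : ∀ x s m → (∀ i → m ≤ square (+ x - + (3 N.+ i)) N.+ (3 N.+ i)) → t^ m ∣ far x s
  far-order x s m bound = ∣-Σ₅ (λ y → step x y (A s y)) (applyUpTo (λ i → 3 N.+ i) B')
    (applyUpTo⁺₂ (λ i → 3 N.+ i) B' λ i →
      ∣-weaken {n = square (+ x - + (3 N.+ i)) N.+ (3 N.+ i)} (bound i)
               (∣-t^ (square (+ x - + (3 N.+ i))) (∣-*₅ {m = 3 N.+ i} (D x) (A-order s (3 N.+ i)))))

  gap-bound : ∀ j g i → j ≤ g → j N.+ 3 ≤ g N.+ (3 N.+ i)
  gap-bound j g i j≤g = NP.+-mono-≤ j≤g (NP.m≤m+n 3 i)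

  far-0 : ∀ s → far 0 s ≡ 0₅
  far-0 s = ∣-vanishes (far-order 0 s 5 λ i → gap-bound 2 (square (+ 0 - + (3 N.+ i))) i (s≤s (s≤s z≤n)))

  far-1 : ∀ s → t^ 4 ∣ far 1 s
  far-1 s = far-order 1 s 4 λ i → gap-bound 1 (square (+ 1 - + (3 N.+ i))) i (s≤s z≤n)

  far-2 : ∀ s → t^ 4 ∣ far 2 s
  far-2 s = far-order 2 s 4 λ i → gap-bound 1 (square (+ 2 - + (3 N.+ i))) i (s≤s z≤n)

  near : ℕ → (Jet₅ → Jet₅) → Jet₅ → Jet₅ → Jet₅ → Jet₅ → Jet₅
  near x h a b c r =
    t^ square (+ x - + 0) · h a +₅ (t^ square (+ x - + 1) · h b +₅ (t^ square (+ x - + 2) · h c +₅ r))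

  near-cong : ∀ x {h h' a a' b b' c c' r r'} → (∀ z → h z ≡ h' z) →
    a ≡ a' → b ≡ b' → c ≡ c' → r ≡ r' → near x h a b c r ≡ near x h' a' b' c' r'
  near-cong x {a = a} {b = b} {c = c} h≡ refl refl refl refl =
    cong₂ _+₅_ (shifted 0 (h≡ a)) (cong₂ _+₅_ (shifted 1 (h≡ b)) (cong₂ _+₅_ (shifted 2 (h≡ c)) refl))
    where
    shifted : ∀ y {z z'} → z ≡ z' → t^ square (+ x - + y) · z ≡ t^ square (+ x - + y) · z'
    shifted y = cong (λ z → t^ square (+ x - + y) · z)

  split : ∀ s x → A (suc s) x ≡ near x (D x *₅_) (A s 0) (A s 1) (A s 2) (far x s)
  split s x = transfer s x

  -- What the recursion needs to know about A_s(0), A_s(1), A_s(2).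
  record Profile (s : ℕ) : Set where
    field
      at0 : A s 0 ≡ jet₅ (+ 1) +0 (tri s) +0 (α s)
      at1 : A s 1 ≡ jet₅ +0 (+ 1 + + s) +0 (β s) (t4 (A s 1))
      at2 : A s 2 ≡ jet₅ +0 +0 (tri s) (t3 (A s 2)) (t4 (A s 2))

  -- The profile recurrences: one transfer step, using the explicit jets of
  -- 1/(q)²_x for x ≤ 2 and the bounds on the far terms.
  profile-step : ∀ s → Profile s → Profile (suc s)
  profile-step s p = record { at0 = next0 ; at1 = next1 ; at2 = next2 }
    where
    open Profile p
    stepped : ℕ → ℤ → ℤ → Jet₅ → Jet₅
    stepped x k2 k4 r = near x (evenUnit k2 k4) (jet₅ (+ 1) +0 (tri s) +0 (α s))
                          (jet₅ +0 (+ 1 + + s) +0 (β s) (t4 (A s 1)))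
                          (jet₅ +0 +0 (tri s) (t3 (A s 2)) (t4 (A s 2))) r
    expand : ∀ x k2 k4 {r} → (∀ z → D x *₅ z ≡ evenUnit k2 k4 z) → far x s ≡ r →
      A (suc s) x ≡ stepped x k2 k4 r
    expand x k2 k4 D≡ far≡ = trans (split s x) (near-cong x D≡ at0 at1 at2 far≡)
    -- 1/(q)²₀ = 1,  1/(q)²₁ ≡ 1 + 2q + 3q²,  1/(q)²₂ ≡ 1 + 2q + 5q²  (mod q³).
    e0 : A (suc s) 0 ≡ stepped 0 +0 +0 0₅
    e0 = expand 0 +0 +0 (*₅-evenUnit +0 +0) (far-0 s)
    e1 : A (suc s) 1 ≡ stepped 1 (+ 2) (+ 3) (t^ 4 · proj₁ (far-1 s))
    e1 = expand 1 (+ 2) (+ 3) (*₅-evenUnit (+ 2) (+ 3)) (proj₂ (far-1 s))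
    e2 : A (suc s) 2 ≡ stepped 2 (+ 2) (+ 5) (t^ 4 · proj₁ (far-2 s))
    e2 = expand 2 (+ 2) (+ 5) (*₅-evenUnit (+ 2) (+ 5)) (proj₂ (far-2 s))
    next0 : A (suc s) 0 ≡ jet₅ (+ 1) +0 (tri (suc s)) +0 (α (suc s))
    next0 = trans e0 (jet₅-cong refl refl (c2 (tri s) (+ s)) refl (c4 (α s) (β s)))
      where
      c2 : ∀ T S → T + +0 + (+ 1 + S + +0) ≡ T + (+ 1 + S)
      c2 = solve-∀
      c4 : ∀ a b → a + +0 + +0 + (b + +0 + +0) ≡ a + b
      c4 = solve-∀
    next1 : A (suc s) 1 ≡ jet₅ +0 (+ 1 + + suc s) +0 (β (suc s)) (t4 (A (suc s) 1))
    next1 = jet₅-cong (cong t0 e1) (trans (cong t1 e1) (c1 (+ s))) (cong t2 e1)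
                      (trans (cong t3 e1) (c3 (tri s) (+ s) (β s))) refl
      where
      c1 : ∀ S → + 1 + (+ 1 + S + +0) ≡ + 1 + (+ 1 + S)
      c1 = solve-∀
      c3 : ∀ T S b → T + + 2 + (b + + 2 * (+ 1 + S) + (T + +0 + +0)) ≡ b + T + T + + 2 + + 2 * (+ 1 + S)
      c3 = solve-∀
    next2 : A (suc s) 2 ≡ jet₅ +0 +0 (tri (suc s)) (t3 (A (suc s) 2)) (t4 (A (suc s) 2))
    next2 = jet₅-cong (cong t0 e2) (cong t1 e2) (trans (cong t2 e2) (c2 (tri s) (+ s))) refl refl
      where
      c2 : ∀ T S → +0 + (+ 1 + S + (T + +0 + +0)) ≡ T + (+ 1 + S)
      c2 = solve-∀

  -- At s = 0, A₀(x) = t^{x²}/(q)²_x, which computes directly.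
  profile : ∀ s → Profile s
  profile zero    = record { at0 = refl ; at1 = refl ; at2 = refl }
  profile (suc s) = profile-step s (profile s)

  multisum-profile : ∀ d → ⌊ multisumBox d (suc (suc B')) ⌋₃ ≡ jet₃ (+ 1) (tri d) (α d)
  multisum-profile d = trans (multisum-jet d) (cong even (Profile.at0 (profile d)))

multisum-jet₃ : ∀ d B → 2 ≤ B → ⌊ multisumBox d B ⌋₃ ≡ jet₃ (+ 1) (tri d) (α d)
multisum-jet₃ d .(suc (suc B')) (s≤s (s≤s {n = B'} _)) = LargeBox.multisum-profile B' d

tri-closed : ∀ s → tri s + tri s ≡ + s * (+ s + + 1)
tri-closed zero    = refl
tri-closed (suc s) = begin
  (tri s + (+ 1 + + s)) + (tri s + (+ 1 + + s)) ≡⟨ regroup (tri s) (+ s) ⟩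
  (tri s + tri s) + + 2 * (+ 1 + + s)           ≡⟨ cong (λ T → T + + 2 * (+ 1 + + s)) (tri-closed s) ⟩
  + s * (+ s + + 1) + + 2 * (+ 1 + + s)         ≡⟨ expand (+ s) ⟩
  (+ 1 + + s) * ((+ 1 + + s) + + 1)             ∎
  where
  regroup : ∀ T S → (T + (+ 1 + S)) + (T + (+ 1 + S)) ≡ (T + T) + + 2 * (+ 1 + S)
  regroup = solve-∀
  expand : ∀ S → S * (S + + 1) + + 2 * (+ 1 + S) ≡ (+ 1 + S) * ((+ 1 + S) + + 1)
  expand = solve-∀

β-closed : ∀ s → + 6 * β s ≡ + 2 * (+ s * + s * + s) + + 6 * (+ s * + s) + + 16 * + s + + 12
β-closed zero    = refl
β-closed (suc s) = begin
  + 6 * (β s + tri s + tri s + + 2 + + 2 * (+ 1 + + s))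
    ≡⟨ regroup (β s) (tri s) (+ s) ⟩
  + 6 * β s + + 6 * (tri s + tri s) + + 12 + + 12 * (+ 1 + + s)
    ≡⟨ cong₂ (λ b t → b + + 6 * t + + 12 + + 12 * (+ 1 + + s)) (β-closed s) (tri-closed s) ⟩
  (+ 2 * (+ s * + s * + s) + + 6 * (+ s * + s) + + 16 * + s + + 12) + + 6 * (+ s * (+ s + + 1)) + + 12 + + 12 * (+ 1 + + s)
    ≡⟨ expand (+ s) ⟩
  + 2 * (S′ * S′ * S′) + + 6 * (S′ * S′) + + 16 * S′ + + 12 ∎
  where
  S′ : ℤ
  S′ = + 1 + + s
  regroup : ∀ b T S → + 6 * (b + T + T + + 2 + + 2 * (+ 1 + S))
                    ≡ + 6 * b + + 6 * (T + T) + + 12 + + 12 * (+ 1 + S)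
  regroup = solve-∀
  expand : ∀ S → (+ 2 * (S * S * S) + + 6 * (S * S) + + 16 * S + + 12) + + 6 * (S * (S + + 1)) + + 12 + + 12 * (+ 1 + S)
               ≡ + 2 * ((+ 1 + S) * (+ 1 + S) * (+ 1 + S)) + + 6 * ((+ 1 + S) * (+ 1 + S)) + + 16 * (+ 1 + S) + + 12
  expand = solve-∀

α-poly : ℤ → ℤ
α-poly S = S * S * (S - + 1) * (S - + 1) + + 2 * (S - + 1) * S * (+ 2 * S - + 1) + + 16 * S * (S - + 1) + + 24 * S

α-closed : ∀ s → + 12 * α s ≡ α-poly (+ s)
α-closed zero    = refl
α-closed (suc s) = begin
  + 12 * (α s + β s)                     ≡⟨ regroup (α s) (β s) ⟩
  + 12 * α s + + 2 * (+ 6 * β s)         ≡⟨ cong₂ (λ a b → a + + 2 * b) (α-closed s) (β-closed s) ⟩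
  α-poly (+ s) + + 2 * (+ 2 * (+ s * + s * + s) + + 6 * (+ s * + s) + + 16 * + s + + 12)
                                         ≡⟨ expand (+ s) ⟩
  α-poly (+ 1 + + s)                     ∎
  where
  regroup : ∀ a b → + 12 * (a + b) ≡ + 12 * a + + 2 * (+ 6 * b)
  regroup = solve-∀
  expand : ∀ S → (S * S * (S - + 1) * (S - + 1) + + 2 * (S - + 1) * S * (+ 2 * S - + 1) + + 16 * S * (S - + 1) + + 24 * S)
                 + + 2 * (+ 2 * (S * S * S) + + 6 * (S * S) + + 16 * S + + 12)
               ≡ (+ 1 + S) * (+ 1 + S) * ((+ 1 + S) - + 1) * ((+ 1 + S) - + 1)
                 + + 2 * ((+ 1 + S) - + 1) * (+ 1 + S) * (+ 2 * (+ 1 + S) - + 1)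
                 + + 16 * (+ 1 + S) * ((+ 1 + S) - + 1) + + 24 * (+ 1 + S)
  expand = solve-∀

-- The q²-coefficient of (q)_∞ⁿ = (1 − q − q² + …)ⁿ.
π₂ : ℕ → ℤ
π₂ zero    = +0
π₂ (suc n) = π₂ n + + n - + 1

π₂-closed : ∀ n → + 2 * π₂ n ≡ + n * + n - + 3 * + n
π₂-closed zero    = refl
π₂-closed (suc n) = begin
  + 2 * (π₂ n + + n - + 1)                 ≡⟨ regroup (π₂ n) (+ n) ⟩
  + 2 * π₂ n + + 2 * + n - + 2             ≡⟨ cong (λ p → p + + 2 * + n - + 2) (π₂-closed n) ⟩
  + n * + n - + 3 * + n + + 2 * + n - + 2  ≡⟨ expand (+ n) ⟩
  (+ 1 + + n) * (+ 1 + + n) - + 3 * (+ 1 + + n) ∎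
  where
  regroup : ∀ P N → + 2 * (P + N - + 1) ≡ + 2 * P + + 2 * N - + 2
  regroup = solve-∀
  expand : ∀ N → N * N - + 3 * N + + 2 * N - + 2 ≡ (+ 1 + N) * (+ 1 + N) - + 3 * (+ 1 + N)
  expand = solve-∀

-- (q)_∞ ≡ 1 − q − q², hence (q)_∞ⁿ ≡ 1 − n q + π₂(n) q² (mod q³).
pochInf-power : ∀ n → ⌊ powS pochInf n ⌋₃ ≡ jet₃ (+ 1) (- + n) (π₂ n)
pochInf-power zero    = refl
pochInf-power (suc n) = begin
  ⌊ powS pochInf n ⌋₃ *₃ ⌊ pochInf ⌋₃             ≡⟨ cong (_*₃ ⌊ pochInf ⌋₃) (pochInf-power n) ⟩
  jet₃ (+ 1) (- + n) (π₂ n) *₃ jet₃ (+ 1) (- + 1) (- + 1)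
                                                  ≡⟨ jet₃-cong refl (c1 (+ n)) (c2 (+ n) (π₂ n)) ⟩
  jet₃ (+ 1) (- + suc n) (π₂ (suc n))             ∎
  where
  c1 : ∀ N → + 1 * (- + 1) + (- N) * + 1 ≡ - (+ 1 + N)
  c1 = solve-∀
  c2 : ∀ N P → (+ 1 * (- + 1) + (- N) * (- + 1)) + P * + 1 ≡ P + N - + 1
  c2 = solve-∀

FJet : ℕ → Jet₃
FJet n = jet₃ (+ 1) (- + n) (π₂ n) *₃ jet₃ (+ 1) (tri n) (α n)

FkBox-jet : ∀ k B → 2 ≤ B → ⌊ FkBox k B ⌋₃ ≡ FJet (suc (2 N.* k))
FkBox-jet k B 2≤B = begin
  ⌊ FkBox k B ⌋₃                                  ≡⟨ ⌊⌋₃-⊛ (powS pochInf n) (multisumBox n B) ⟩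
  ⌊ powS pochInf n ⌋₃ *₃ ⌊ multisumBox n B ⌋₃     ≡⟨ cong₂ _*₃_ (pochInf-power n) (multisum-jet₃ n B 2≤B) ⟩
  FJet n                                          ∎
  where
  n : ℕ
  n = suc (2 N.* k)

FJet-q1 : ∀ n → + 2 * q1 (FJet n) ≡ + n * (+ n + + 1) - (+ n + + n)
FJet-q1 n = trans (regroup (tri n) (+ n)) (cong (λ T → T - (+ n + + n)) (tri-closed n))
  where
  regroup : ∀ T N → + 2 * (+ 1 * T + (- N) * + 1) ≡ (T + T) - (N + N)
  regroup = solve-∀

FJet-q2 : ∀ n → + 12 * (+ 3 * q2 (FJet n))
                ≡ + 3 * α-poly (+ n) - + 18 * + n * (+ n * (+ n + + 1)) + + 18 * (+ n * + n - + 3 * + n)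
FJet-q2 n = begin
  + 12 * (+ 3 * ((+ 1 * α n + (- + n) * tri n) + π₂ n * + 1))
    ≡⟨ regroup (α n) (tri n) (π₂ n) (+ n) ⟩
  + 3 * (+ 12 * α n) - + 18 * + n * (tri n + tri n) + + 18 * (+ 2 * π₂ n)
    ≡⟨ cong₂ (λ a t → + 3 * a - + 18 * + n * t + + 18 * (+ 2 * π₂ n)) (α-closed n) (tri-closed n) ⟩
  + 3 * α-poly (+ n) - + 18 * + n * (+ n * (+ n + + 1)) + + 18 * (+ 2 * π₂ n)
    ≡⟨ cong (λ p → + 3 * α-poly (+ n) - + 18 * + n * (+ n * (+ n + + 1)) + + 18 * p) (π₂-closed n) ⟩
  + 3 * α-poly (+ n) - + 18 * + n * (+ n * (+ n + + 1)) + + 18 * (+ n * + n - + 3 * + n) ∎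
  where
  regroup : ∀ a T P N → + 12 * (+ 3 * ((+ 1 * a + (- N) * T) + P * + 1))
                      ≡ + 3 * (+ 12 * a) - + 18 * N * (T + T) + + 18 * (+ 2 * P)
  regroup = solve-∀

odd-cast : ∀ k → + suc (2 N.* k) ≡ + 1 + + 2 * + k
odd-cast k = cong (λ m → + 1 + m) (ZP.pos-* 2 k)

target₁-cast : ∀ k → + ((2 N.* k N.+ 1) N.* k) ≡ (+ 2 * + k + + 1) * + k
target₁-cast k = begin
  + ((2 N.* k N.+ 1) N.* k)   ≡⟨ ZP.pos-* (2 N.* k N.+ 1) k ⟩
  + (2 N.* k N.+ 1) * + k     ≡⟨ cong (λ m → m * + k) (ZP.pos-+ (2 N.* k) 1) ⟩
  (+ (2 N.* k) + + 1) * + k   ≡⟨ cong (λ m → (m + + 1) * + k) (ZP.pos-* 2 k) ⟩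
  (+ 2 * + k + + 1) * + k     ∎

target₂-cast : ∀ k → + (k N.* (3 N.+ 5 N.* k N.+ 4 N.* (k N.^ 3)))
                   ≡ + k * ((+ 3 + + 5 * + k) + + 4 * (+ k * (+ k * + k)))
target₂-cast k = begin
  + (k N.* (3 N.+ 5 N.* k N.+ 4 N.* (k N.^ 3)))
    ≡⟨ ZP.pos-* k _ ⟩
  + k * + (3 N.+ 5 N.* k N.+ 4 N.* (k N.^ 3))
    ≡⟨ cong (λ m → + k * m) (ZP.pos-+ (3 N.+ 5 N.* k) _) ⟩
  + k * (+ (3 N.+ 5 N.* k) + + (4 N.* (k N.^ 3)))
    ≡⟨ cong₂ (λ a c → + k * (a + c)) (cong (λ m → + 3 + m) (ZP.pos-* 5 k))
                                      (trans (ZP.pos-* 4 (k N.^ 3)) (cong (λ m → + 4 * m) cube)) ⟩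
  + k * ((+ 3 + + 5 * + k) + + 4 * (+ k * (+ k * + k))) ∎
  where
  cube : + (k N.^ 3) ≡ + k * (+ k * + k)
  cube = begin
    + (k N.* (k N.* (k N.* 1))) ≡⟨ cong (λ m → + (k N.* (k N.* m))) (NP.*-identityʳ k) ⟩
    + (k N.* (k N.* k))         ≡⟨ ZP.pos-* k (k N.* k) ⟩
    + k * + (k N.* k)           ≡⟨ cong (λ m → + k * m) (ZP.pos-* k k) ⟩
    + k * (+ k * + k)           ∎

Fk-coefficient₁ : ∀ k → q1 (FJet (suc (2 N.* k))) ≡ + ((2 N.* k N.+ 1) N.* k)
Fk-coefficient₁ k = ZP.*-cancelˡ-≡ (+ 2) _ _ (begin
  + 2 * q1 (FJet n)                                    ≡⟨ FJet-q1 n ⟩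
  + n * (+ n + + 1) - (+ n + + n)                      ≡⟨ cong (λ N → N * (N + + 1) - (N + N)) (odd-cast k) ⟩
  (+ 1 + + 2 * K) * ((+ 1 + + 2 * K) + + 1) - ((+ 1 + + 2 * K) + (+ 1 + + 2 * K))
                                                       ≡⟨ expand K ⟩
  + 2 * ((+ 2 * K + + 1) * K)                          ≡⟨ cong (λ m → + 2 * m) (sym (target₁-cast k)) ⟩
  + 2 * + ((2 N.* k N.+ 1) N.* k)                      ∎)
  where
  n : ℕ
  n = suc (2 N.* k)
  K : ℤ
  K = + k
  expand : ∀ K → (+ 1 + + 2 * K) * ((+ 1 + + 2 * K) + + 1) - ((+ 1 + + 2 * K) + (+ 1 + + 2 * K))
               ≡ + 2 * ((+ 2 * K + + 1) * K)
  expand = solve-∀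

Fk-coefficient₂ : ∀ k → + 3 * q2 (FJet (suc (2 N.* k))) ≡ + (k N.* (3 N.+ 5 N.* k N.+ 4 N.* (k N.^ 3)))
Fk-coefficient₂ k = ZP.*-cancelˡ-≡ (+ 12) _ _ (begin
  + 12 * (+ 3 * q2 (FJet n))
    ≡⟨ FJet-q2 n ⟩
  + 3 * α-poly (+ n) - + 18 * + n * (+ n * (+ n + + 1)) + + 18 * (+ n * + n - + 3 * + n)
    ≡⟨ cong (λ N → + 3 * α-poly N - + 18 * N * (N * (N + + 1)) + + 18 * (N * N - + 3 * N)) (odd-cast k) ⟩
  + 3 * α-poly N′ - + 18 * N′ * (N′ * (N′ + + 1)) + + 18 * (N′ * N′ - + 3 * N′)
    ≡⟨ expand (+ k) ⟩
  + 12 * (+ k * ((+ 3 + + 5 * + k) + + 4 * (+ k * (+ k * + k))))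
    ≡⟨ cong (λ m → + 12 * m) (sym (target₂-cast k)) ⟩
  + 12 * + (k N.* (3 N.+ 5 N.* k N.+ 4 N.* (k N.^ 3))) ∎)
  where
  n : ℕ
  n = suc (2 N.* k)
  N′ : ℤ
  N′ = + 1 + + 2 * + k
  expand : ∀ K → let N = + 1 + + 2 * K in
      + 3 * (N * N * (N - + 1) * (N - + 1) + + 2 * (N - + 1) * N * (+ 2 * N - + 1) + + 16 * N * (N - + 1) + + 24 * N)
        - + 18 * N * (N * (N + + 1)) + + 18 * (N * N - + 3 * N)
    ≡ + 12 * (K * ((+ 3 + + 5 * K) + + 4 * (K * (K * K))))
  expand = solve-∀

-- Every box {0..B}ᵈ with B ≥ 2 already gives the stated jet of F_k.
proposition5p3 : (k : ℕ) → 1 ≤ k →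
    ∃ λ N → (B : ℕ) → N ≤ B →
      (FkBox k B 0 ≡ + 1)
      × (FkBox k B 1 ≡ + ((2 N.* k N.+ 1) N.* k))
      × (+ 3 Z.* FkBox k B 2 ≡ + (k N.* (3 N.+ 5 N.* k N.+ 4 N.* (k N.^ 3))))
proposition5p3 k _ = 2 , λ B 2≤B →
    cong q0 (FkBox-jet k B 2≤B)
  , trans (cong q1 (FkBox-jet k B 2≤B)) (Fk-coefficient₁ k)
  , trans (cong (λ F → + 3 * q2 F) (FkBox-jet k B 2≤B)) (Fk-coefficient₂ k)
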